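{- For every constant $k$ there is a graph $G$ such that $\mathcal{D}_{\mathrm{lir}}(G) \geq k$.
   Context: A (multi)graph is locally irregular if the two endvertices of every edge have different degrees (counting parallel edges with multiplicity). For a graph $G$ and $E_d \subseteq E(G)$, $G + E_d$ is the multigraph obtained by replacing each edge of $E_d$ by two parallel edges. For a connected graph $G$ not isomorphic to $K_2$ or $K_3$, $\mathcal{D}_{\mathrm{lir}}(G)$ is the minimum size of a set $E_d \subseteq E(G)$ such that the edges of $G+E_d$ can be colored with at most two colors so that each color class induces a locally irregular submultigraph and parallel edges receive the same color. -}

module Defs where

open import Data.Nat using (ℕ; zero; suc; _+_; _≤_; _<_; _<?_)
open import Data.Fin using (Fin; toℕ; _≟_) renaming (zero to fz; suc to fs)
open import Data.Bool using (Bool; true; false; if_then_else_; not; _∧_)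
open import Data.Product using (Σ; _×_; _,_)
open import Relation.Nullary using (¬_; yes; no)
open import Relation.Nullary.Decidable using (⌊_⌋)
open import Relation.Binary.PropositionalEquality using (_≡_; _≢_; refl; sym)
open import Function.Bundles using (_↔_; Inverse)
open import Data.Empty using (⊥-elim)

record Graph : Set where
  field
    n      : ℕ
    adj    : Fin n → Fin n → Bool
    adjSym : ∀ i j → adj i j ≡ adj j i
    loopless : ∀ i → adj i i ≡ false
open Graph public

sumFin : (m : ℕ) → (Fin m → ℕ) → ℕ
sumFin zero    f = 0
sumFin (suc m) f = f fz + sumFin m (λ i → f (fs i))

K : ℕ → Graph
K m = record { n = m ; adj = λ i j → not ⌊ i ≟ j ⌋ ; adjSym = s ; loopless = l }
  where
  s : ∀ i j → not ⌊ i ≟ j ⌋ ≡ not ⌊ j ≟ i ⌋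
  s i j with i ≟ j | j ≟ i
  ... | yes _ | yes _ = refl
  ... | no _  | no _  = refl
  ... | yes p | no q  = ⊥-elim (q (sym p))
  ... | no p  | yes q = ⊥-elim (p (sym q))
  l : ∀ i → not ⌊ i ≟ i ⌋ ≡ false
  l i with i ≟ i
  ... | yes _ = refl
  ... | no p  = ⊥-elim (p refl)

Isomorphic : Graph → Graph → Set
Isomorphic G H = Σ (Fin (n G) ↔ Fin (n H)) λ φ →
  ∀ i j → adj H (Inverse.to φ i) (Inverse.to φ j) ≡ adj G i j

data Reach (G : Graph) : Fin (n G) → Fin (n G) → Set where
  here : ∀ {u} → Reach G u u
  step : ∀ {u w v} → adj G u w ≡ true → Reach G w v → Reach G u v

Connected : Graph → Set
Connected G = (1 ≤ n G) × (∀ u v → Reach G u v)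

-- A set E_d ⊆ E(G) of edges to be doubled, as a symmetric Boolean
-- function supported on the edges of G.
record EdgeSet (G : Graph) : Set where
  field
    mem    : Fin (n G) → Fin (n G) → Bool
    memSym : ∀ i j → mem i j ≡ mem j i
    memSub : ∀ i j → mem i j ≡ true → adj G i j ≡ true
open EdgeSet public

-- |E_d|: number of unordered pairs {i,j} (counted once via toℕ i < toℕ j)
-- that belong to E_d.
size : (G : Graph) → EdgeSet G → ℕ
size G D = sumFin (n G) λ i → sumFin (n G) λ j →
  if ⌊ toℕ i <? toℕ j ⌋ ∧ mem D i j then 1 else 0

mult : (G : Graph) → EdgeSet G → Fin (n G) → Fin (n G) → ℕ
mult G D i j = if adj G i j then (if mem D i j then 2 else 1) else 0

-- A 2-edge-colouring of G + E_d: a colour (Bool) for each edge of G,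
-- shared by parallel copies. Given as a symmetric function on vertex pairs.
record Colouring (G : Graph) : Set where
  field
    col    : Fin (n G) → Fin (n G) → Bool
    colSym : ∀ i j → col i j ≡ col j i
open Colouring public

sameCol : Bool → Bool → Bool
sameCol true  b = b
sameCol false b = not b

degIn : (G : Graph) → EdgeSet G → Colouring G → Bool → Fin (n G) → ℕ
degIn G D c b v = sumFin (n G) λ u →
  if sameCol b (col c v u) then mult G D v u else 0

LocallyIrregularColouring : (G : Graph) → EdgeSet G → Colouring G → Set
LocallyIrregularColouring G D c =
  ∀ (b : Bool) u v → adj G u v ≡ true → col c u v ≡ b →
    degIn G D c b u ≢ degIn G D c b v

Admissible : (G : Graph) → EdgeSet G → Set
Admissible G D = Σ (Colouring G) λ c → LocallyIrregularColouring G D c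

-- D_lir(G) ≥ k: D_lir(G) is defined (some admissible E_d exists) and every
-- admissible E_d has size at least k.
DlirAtLeast : Graph → ℕ → Set
DlirAtLeast G k = Σ (EdgeSet G) (Admissible G) × (∀ D → Admissible G D → k ≤ size G D)

-- Take m = 3 + k copies of the gadget "K₄ with a pendant vertex" and join all
-- pendant vertices to a common hub. The degrees of the K₄ vertices of a copy only
-- see that copy, and no 2-colouring of K₄ is locally irregular when one of its
-- vertices has a single extra undoubled edge; hence every admissible E_d doubles
-- an edge in each copy, and |E_d| ≥ m ≥ k. Doubling one K₄ edge in every copy is
-- admissible, so D_lir(G) is defined.

module Submission where

open import Defs
open import Data.Nat using (ℕ; zero; suc; _+_; _*_; _≤_; _<_; z≤n; s≤s; _<?_)
import Data.Nat as ℕ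
open import Data.Nat.Properties
  using (module ≤-Reasoning; ≤-trans; +-mono-≤; +-assoc; +-identityʳ; m≤m+n; m≤n+m; +-monoʳ-<)
open import Data.Fin using (Fin; toℕ; _≟_; combine; remQuot; _↑ˡ_; _↑ʳ_; inject₁)
  renaming (zero to fz; suc to fs)
open import Data.Fin.Patterns
open import Data.Fin.Properties
  using (remQuot-combine; combine-remQuot; toℕ-combine; suc-injective; fromℕ≢inject₁; <-cmp; any?; all?)
open import Data.Fin.Subset.Properties using (anySubset?)
open import Data.Fin.Permutation using (↔⇒≡)
open import Data.Vec using (Vec; lookup; tabulate)
open import Data.Vec.Properties using (lookup∘tabulate)
open import Data.Bool using (Bool; true; false; if_then_else_; not; _∧_)
import Data.Bool as Bool
open import Data.Bool.Properties using (¬-not; ∧-zeroʳ)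
open import Data.Product using (Σ; ∃₂; _×_; _,_; proj₁; proj₂; uncurry)
open import Data.Product.Properties using (≡-dec)
open import Data.Sum using (_⊎_; inj₁; inj₂)
open import Data.Empty using (⊥-elim)
open import Relation.Binary.Definitions using (tri<; tri≈; tri>)
open import Relation.Nullary using (¬_; Dec; yes; no; contradiction)
open import Relation.Nullary.Decidable
  using (⌊_⌋; isYes≗does; dec-true; dec-false; from-yes; from-no; _×-dec_; _⊎-dec_; _→-dec_; ¬?)
open import Relation.Binary.PropositionalEquality
open import Function using (_∘_)

sumFin-cong : ∀ m {f g : Fin m → ℕ} → (∀ i → f i ≡ g i) → sumFin m f ≡ sumFin m g
sumFin-cong zero    f≡g = refl
sumFin-cong (suc m) f≡g = cong₂ _+_ (f≡g fz) (sumFin-cong m (λ i → f≡g (fs i)))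

sumFin-mono : ∀ m {f g : Fin m → ℕ} → (∀ i → f i ≤ g i) → sumFin m f ≤ sumFin m g
sumFin-mono zero    f≤g = z≤n
sumFin-mono (suc m) f≤g = +-mono-≤ (f≤g fz) (sumFin-mono m (λ i → f≤g (fs i)))

term≤sumFin : ∀ m (f : Fin m → ℕ) i → f i ≤ sumFin m f
term≤sumFin (suc m) f fz     = m≤m+n (f fz) _
term≤sumFin (suc m) f (fs i) = ≤-trans (term≤sumFin m (λ j → f (fs j)) i) (m≤n+m _ (f fz))

sumFin-one : ∀ m → sumFin m (λ _ → 1) ≡ m
sumFin-one zero    = refl
sumFin-one (suc m) = cong suc (sumFin-one m)

sumFin-zero : ∀ m {f : Fin m → ℕ} → (∀ i → f i ≡ 0) → sumFin m f ≡ 0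
sumFin-zero zero    f≡0 = refl
sumFin-zero (suc m) f≡0 = cong₂ _+_ (f≡0 fz) (sumFin-zero m (λ i → f≡0 (fs i)))

sumFin-single : ∀ m (f : Fin m → ℕ) i → (∀ j → j ≢ i → f j ≡ 0) → sumFin m f ≡ f i
sumFin-single (suc m) f fz     f≡0 = begin
  f fz + sumFin m (λ j → f (fs j)) ≡⟨ cong (f fz +_) (sumFin-zero m (λ j → f≡0 (fs j) λ ())) ⟩
  f fz + 0                         ≡⟨ +-identityʳ (f fz) ⟩
  f fz                             ∎
  where open ≡-Reasoning
sumFin-single (suc m) f (fs i) f≡0 =
  cong₂ _+_ (f≡0 fz λ ()) (sumFin-single m (λ j → f (fs j)) i (λ j j≢i → f≡0 (fs j) (j≢i ∘ suc-injective)))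

sumFin-↑ : ∀ a b (f : Fin (a + b) → ℕ) →
  sumFin (a + b) f ≡ sumFin a (λ i → f (i ↑ˡ b)) + sumFin b (λ j → f (a ↑ʳ j))
sumFin-↑ zero    b f = refl
sumFin-↑ (suc a) b f =
  trans (cong (f fz +_) (sumFin-↑ a b (λ i → f (fs i)))) (sym (+-assoc (f fz) _ _))

sumFin-combine : ∀ m k (f : Fin (m * k) → ℕ) →
  sumFin (m * k) f ≡ sumFin m (λ i → sumFin k (λ j → f (combine i j)))
sumFin-combine zero    k f = refl
sumFin-combine (suc m) k f =
  trans (sumFin-↑ k (m * k) f) (cong (sumFin k (λ j → f (j ↑ˡ m * k)) +_) (sumFin-combine m k (λ x → f (k ↑ʳ x))))

⌊≟⌋-refl : ∀ {k} (i : Fin k) → ⌊ i ≟ i ⌋ ≡ true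
⌊≟⌋-refl i = trans (isYes≗does (i ≟ i)) (dec-true (i ≟ i) refl)

⌊≟⌋-≢ : ∀ {k} {i j : Fin k} → i ≢ j → ⌊ i ≟ j ⌋ ≡ false
⌊≟⌋-≢ {i = i} {j} i≢j = trans (isYes≗does (i ≟ j)) (dec-false (i ≟ j) i≢j)

⌊≟⌋-sym : ∀ {k} (i j : Fin k) → ⌊ i ≟ j ⌋ ≡ ⌊ j ≟ i ⌋
⌊≟⌋-sym i j with i ≟ j
... | yes refl = sym (⌊≟⌋-refl i)
... | no i≢j   = sym (⌊≟⌋-≢ (i≢j ∘ sym))

Reach-snoc : ∀ {G u w v} → Reach G u w → adj G w v ≡ true → Reach G u v
Reach-snoc here       e′ = step e′ here
Reach-snoc (step e r) e′ = step e (Reach-snoc r e′)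

Reach-sym : ∀ {G u v} → Reach G u v → Reach G v u
Reach-sym     here       = here
Reach-sym {G} (step e r) = Reach-snoc (Reach-sym r) (trans (adjSym G _ _) e)

Reach-trans : ∀ {G u w v} → Reach G u w → Reach G w v → Reach G u v
Reach-trans here       r′ = r′
Reach-trans (step e r) r′ = step e (Reach-trans r r′)

connected-via : ∀ G (centre : Fin (n G)) → (∀ u → Reach G u centre) → Connected G
connected-via G centre toCentre =
  nonempty centre , λ u v → Reach-trans (toCentre u) (Reach-sym (toCentre v))
  where
  nonempty : ∀ {k} → Fin k → 1 ≤ k
  nonempty fz     = s≤s z≤n
  nonempty (fs _) = s≤s z≤n

Isomorphic⇒≡ : ∀ G H → Isomorphic G H → n G ≡ n H
Isomorphic⇒≡ G H (φ , _) = ↔⇒≡ φ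

-- degIn G D c b v unfolds to the sum over u of weight b (col c v u) (adj G v u) (mem D v u).
weight : (b colour adjacent doubled : Bool) → ℕ
weight b colour adjacent doubled = if sameCol b colour then (if adjacent then (if doubled then 2 else 1) else 0) else 0

weight-nonadjacent : ∀ b colour doubled → weight b colour false doubled ≡ 0
weight-nonadjacent b colour doubled with sameCol b colour
... | true  = refl
... | false = refl

degIn-cong : ∀ G {D D′ : EdgeSet G} {c c′ : Colouring G} b v →
  (∀ u → mem D v u ≡ mem D′ v u) → (∀ u → col c v u ≡ col c′ v u) →
  degIn G D c b v ≡ degIn G D′ c′ b v
degIn-cong G b v mem≡ col≡ =
  sumFin-cong (n G) (λ u → cong₂ (λ colour doubled → weight b colour (adj G v u) doubled) (col≡ u) (mem≡ u))

HasDoubledEdge : (G : Graph) → EdgeSet G → Set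
HasDoubledEdge G D = ∃₂ λ a b → toℕ a < toℕ b × mem D a b ≡ true

hasDoubledEdge? : ∀ G (D : EdgeSet G) → HasDoubledEdge G D ⊎ (∀ a b → mem D a b ≡ false)
hasDoubledEdge? G D with any? (λ a → any? (λ b → (toℕ a <? toℕ b) ×-dec (mem D a b Bool.≟ true)))
... | yes (a , b , doubled) = inj₁ (a , b , doubled)
... | no none = inj₂ undoubled
  where
  ordered : ∀ a b → toℕ a < toℕ b → mem D a b ≡ false
  ordered a b a<b = ¬-not (λ doubled → none (a , b , a<b , doubled))

  undoubled : ∀ a b → mem D a b ≡ false
  undoubled a b with <-cmp a b
  ... | tri< a<b _ _ = ordered a b a<b
  ... | tri> _ _ b<a = trans (memSym D a b) (ordered b a b<a)
  ... | tri≈ _ refl _ = ¬-not (λ doubled → contradiction (trans (sym (loopless G a)) (memSub D a a doubled)) λ ())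

-- Degrees in a graph whose root r receives one extra edge (to the hub) of
-- colour hubColour, doubled iff hubDoubled.
rootedDeg : ∀ H → Fin (n H) → EdgeSet H → Colouring H → (hubColour hubDoubled : Bool) → Bool → Fin (n H) → ℕ
rootedDeg H r D c hubColour hubDoubled b a = weight b hubColour ⌊ a ≟ r ⌋ hubDoubled + degIn H D c b a

RootedIrregular : ∀ H → Fin (n H) → EdgeSet H → Colouring H → (hubColour hubDoubled : Bool) → Set
RootedIrregular H r D c hubColour hubDoubled = ∀ (b : Bool) a a′ → adj H a a′ ≡ true → col c a a′ ≡ b →
  rootedDeg H r D c hubColour hubDoubled b a ≢ rootedDeg H r D c hubColour hubDoubled b a′

-- m disjoint copies of a rooted graph H whose roots are joined to a new hub

module Hub (H : Graph) (r : Fin (n H)) (m : ℕ) where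

  block : Fin (m * n H) → Fin m
  block x = proj₁ (remQuot {m} (n H) x)

  place : Fin (m * n H) → Fin (n H)
  place x = proj₂ (remQuot {m} (n H) x)

  hubAdj : Fin (suc (m * n H)) → Fin (suc (m * n H)) → Bool
  hubAdj fz     fz     = false
  hubAdj fz     (fs y) = ⌊ place y ≟ r ⌋
  hubAdj (fs x) fz     = ⌊ place x ≟ r ⌋
  hubAdj (fs x) (fs y) = ⌊ block x ≟ block y ⌋ ∧ adj H (place x) (place y)

  hubAdj-sym : ∀ u v → hubAdj u v ≡ hubAdj v u
  hubAdj-sym fz     fz     = refl
  hubAdj-sym fz     (fs y) = refl
  hubAdj-sym (fs x) fz     = refl
  hubAdj-sym (fs x) (fs y) = cong₂ _∧_ (⌊≟⌋-sym (block x) (block y)) (adjSym H (place x) (place y))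

  hubAdj-loopless : ∀ u → hubAdj u u ≡ false
  hubAdj-loopless fz     = refl
  hubAdj-loopless (fs x) = trans (cong (⌊ block x ≟ block x ⌋ ∧_) (loopless H (place x))) (∧-zeroʳ _)

  graph : Graph
  graph = record { n = suc (m * n H) ; adj = hubAdj ; adjSym = hubAdj-sym ; loopless = hubAdj-loopless }

  hub : Fin (n graph)
  hub = fz

  vertex : Fin m → Fin (n H) → Fin (n graph)
  vertex i a = fs (combine i a)

  data VertexView : Fin (n graph) → Set where
    isHub  : VertexView hub
    isCopy : ∀ i a → VertexView (vertex i a)

  view : ∀ u → VertexView u
  view fz     = isHub
  view (fs y) = subst VertexView (cong fs (combine-remQuot {m} (n H) y)) (isCopy (block y) (place y))

  adj-vertex : ∀ i a j b → hubAdj (vertex i a) (vertex j b) ≡ ⌊ i ≟ j ⌋ ∧ adj H a b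
  adj-vertex i a j b =
    cong₂ (λ p q → ⌊ proj₁ p ≟ proj₁ q ⌋ ∧ adj H (proj₂ p) (proj₂ q)) (remQuot-combine i a) (remQuot-combine j b)

  adj-within : ∀ i a b → hubAdj (vertex i a) (vertex i b) ≡ adj H a b
  adj-within i a b = trans (adj-vertex i a i b) (cong (_∧ adj H a b) (⌊≟⌋-refl i))

  adj-across : ∀ {i j} a b → i ≢ j → hubAdj (vertex i a) (vertex j b) ≡ false
  adj-across {i} {j} a b i≢j = trans (adj-vertex i a j b) (cong (_∧ adj H a b) (⌊≟⌋-≢ i≢j))

  adj-vertex-hub : ∀ i a → hubAdj (vertex i a) hub ≡ ⌊ a ≟ r ⌋
  adj-vertex-hub i a = cong (λ p → ⌊ proj₂ p ≟ r ⌋) (remQuot-combine i a)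

  adj-hub-vertex : ∀ i a → hubAdj hub (vertex i a) ≡ ⌊ a ≟ r ⌋
  adj-hub-vertex i a = cong (λ p → ⌊ proj₂ p ≟ r ⌋) (remQuot-combine i a)

  same-block : ∀ i a j b → hubAdj (vertex i a) (vertex j b) ≡ true → i ≡ j
  same-block i a j b e with i ≟ j
  ... | yes i≡j = i≡j
  ... | no i≢j  = contradiction (trans (sym (adj-across a b i≢j)) e) λ ()

  restrictEdges : EdgeSet graph → Fin m → EdgeSet H
  restrictEdges D i = record
    { mem    = λ a b → mem D (vertex i a) (vertex i b)
    ; memSym = λ a b → memSym D (vertex i a) (vertex i b)
    ; memSub = λ a b d → trans (sym (adj-within i a b)) (memSub D (vertex i a) (vertex i b) d)
    }

  restrictColouring : Colouring graph → Fin m → Colouring H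
  restrictColouring c i = record
    { col    = λ a b → col c (vertex i a) (vertex i b)
    ; colSym = λ a b → colSym c (vertex i a) (vertex i b)
    }

  hub-weight : ∀ b a (colour doubled : Fin (n H) → Bool) →
    weight b (colour a) ⌊ a ≟ r ⌋ (doubled a) ≡ weight b (colour r) ⌊ a ≟ r ⌋ (doubled r)
  hub-weight b a colour doubled with a ≟ r
  ... | yes refl = refl
  ... | no _     = trans (weight-nonadjacent b (colour a) (doubled a)) (sym (weight-nonadjacent b (colour r) (doubled r)))

  -- Only the hub and the vertices of its own copy are adjacent to vertex i a.
  degIn-vertex : ∀ D c b i a → degIn graph D c b (vertex i a) ≡
    rootedDeg H r (restrictEdges D i) (restrictColouring c i) (col c (vertex i r) hub) (mem D (vertex i r) hub) b a
  degIn-vertex D c b i a = cong₂ _+_ hubTerm copiesTerm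
    where
    w : Fin (n graph) → ℕ
    w u = weight b (col c (vertex i a) u) (hubAdj (vertex i a) u) (mem D (vertex i a) u)

    hubTerm : w hub ≡ weight b (col c (vertex i r) hub) ⌊ a ≟ r ⌋ (mem D (vertex i r) hub)
    hubTerm = trans (cong (λ adjacent → weight b (col c (vertex i a) hub) adjacent (mem D (vertex i a) hub)) (adj-vertex-hub i a))
                    (hub-weight b a (λ x → col c (vertex i x) hub) (λ x → mem D (vertex i x) hub))

    otherCopy : ∀ j → j ≢ i → sumFin (n H) (λ b′ → w (vertex j b′)) ≡ 0
    otherCopy j j≢i = sumFin-zero (n H) λ b′ →
      trans (cong (λ adjacent → weight b (col c (vertex i a) (vertex j b′)) adjacent (mem D (vertex i a) (vertex j b′)))
                  (adj-across a b′ (j≢i ∘ sym)))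
            (weight-nonadjacent b (col c (vertex i a) (vertex j b′)) (mem D (vertex i a) (vertex j b′)))

    copiesTerm : sumFin (m * n H) (λ y → w (fs y)) ≡ degIn H (restrictEdges D i) (restrictColouring c i) b a
    copiesTerm = begin
      sumFin (m * n H) (λ y → w (fs y))
        ≡⟨ sumFin-combine m (n H) (λ y → w (fs y)) ⟩
      sumFin m (λ j → sumFin (n H) (λ b′ → w (vertex j b′)))
        ≡⟨ sumFin-single m _ i otherCopy ⟩
      sumFin (n H) (λ b′ → w (vertex i b′))
        ≡⟨ sumFin-cong (n H) (λ b′ → cong (λ adjacent → weight b (col c (vertex i a) (vertex i b′)) adjacent
                                                          (mem D (vertex i a) (vertex i b′)))
                                          (adj-within i a b′)) ⟩
      degIn H (restrictEdges D i) (restrictColouring c i) b a ∎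
      where open ≡-Reasoning

  restrict-irregular : ∀ D c → LocallyIrregularColouring graph D c → ∀ i →
    RootedIrregular H r (restrictEdges D i) (restrictColouring c i) (col c (vertex i r) hub) (mem D (vertex i r) hub)
  restrict-irregular D c irregular i b a a′ e col≡b degs≡ =
    irregular b (vertex i a) (vertex i a′) (trans (adj-within i a a′) e) col≡b
      (trans (degIn-vertex D c b i a) (trans degs≡ (sym (degIn-vertex D c b i a′))))

  liftMem : EdgeSet H → Fin (n graph) → Fin (n graph) → Bool
  liftMem D′ (fs x) (fs y) = ⌊ block x ≟ block y ⌋ ∧ mem D′ (place x) (place y)
  liftMem D′ _      _      = false

  liftMem-sym : ∀ D′ u v → liftMem D′ u v ≡ liftMem D′ v u
  liftMem-sym D′ fz     fz     = refl
  liftMem-sym D′ fz     (fs y) = refl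
  liftMem-sym D′ (fs x) fz     = refl
  liftMem-sym D′ (fs x) (fs y) = cong₂ _∧_ (⌊≟⌋-sym (block x) (block y)) (memSym D′ (place x) (place y))

  liftMem-sub : ∀ D′ u v → liftMem D′ u v ≡ true → hubAdj u v ≡ true
  liftMem-sub D′ (fs x) (fs y) d with ⌊ block x ≟ block y ⌋
  ... | true = memSub D′ (place x) (place y) d

  liftEdges : EdgeSet H → EdgeSet graph
  liftEdges D′ = record { mem = liftMem D′ ; memSym = liftMem-sym D′ ; memSub = liftMem-sub D′ }

  liftCol : Colouring H → Fin (n graph) → Fin (n graph) → Bool
  liftCol c′ (fs x) (fs y) = col c′ (place x) (place y)
  liftCol c′ _      _      = true

  liftCol-sym : ∀ c′ u v → liftCol c′ u v ≡ liftCol c′ v u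
  liftCol-sym c′ fz     fz     = refl
  liftCol-sym c′ fz     (fs y) = refl
  liftCol-sym c′ (fs x) fz     = refl
  liftCol-sym c′ (fs x) (fs y) = colSym c′ (place x) (place y)

  liftColouring : Colouring H → Colouring graph
  liftColouring c′ = record { col = liftCol c′ ; colSym = liftCol-sym c′ }

  liftMem-vertex : ∀ D′ i a b → liftMem D′ (vertex i a) (vertex i b) ≡ mem D′ a b
  liftMem-vertex D′ i a b = trans
    (cong₂ (λ p q → ⌊ proj₁ p ≟ proj₁ q ⌋ ∧ mem D′ (proj₂ p) (proj₂ q)) (remQuot-combine i a) (remQuot-combine i b))
    (cong (_∧ mem D′ a b) (⌊≟⌋-refl i))

  liftCol-vertex : ∀ c′ i a j b → liftCol c′ (vertex i a) (vertex j b) ≡ col c′ a b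
  liftCol-vertex c′ i a j b =
    cong₂ (λ p q → col c′ (proj₂ p) (proj₂ q)) (remQuot-combine i a) (remQuot-combine j b)

  degIn-lift : ∀ D′ c′ b i a →
    degIn graph (liftEdges D′) (liftColouring c′) b (vertex i a) ≡ rootedDeg H r D′ c′ true false b a
  degIn-lift D′ c′ b i a = trans (degIn-vertex (liftEdges D′) (liftColouring c′) b i a)
    (cong (weight b true ⌊ a ≟ r ⌋ false +_)
          (degIn-cong H {restrictEdges (liftEdges D′) i} {D′} {restrictColouring (liftColouring c′) i} {c′} b a
                      (liftMem-vertex D′ i a) (liftCol-vertex c′ i a i)))

  degIn-lift-hub : ∀ D′ c′ → degIn graph (liftEdges D′) (liftColouring c′) true hub ≡ m
  degIn-lift-hub D′ c′ = begin
    sumFin (m * n H) (λ y → indicator (hubAdj hub (fs y)))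
      ≡⟨ sumFin-combine m (n H) _ ⟩
    sumFin m (λ i → sumFin (n H) (λ a → indicator (hubAdj hub (vertex i a))))
      ≡⟨ sumFin-cong m (λ i → sumFin-single (n H) _ r (λ a a≢r → cong indicator (trans (adj-hub-vertex i a) (⌊≟⌋-≢ a≢r)))) ⟩
    sumFin m (λ i → indicator (hubAdj hub (vertex i r)))
      ≡⟨ sumFin-cong m (λ i → cong indicator (trans (adj-hub-vertex i r) (⌊≟⌋-refl r))) ⟩
    sumFin m (λ _ → 1)
      ≡⟨ sumFin-one m ⟩
    m ∎
    where
    open ≡-Reasoning
    indicator : Bool → ℕ
    indicator adjacent = if adjacent then 1 else 0

  lift-irregular : ∀ D′ c′ → RootedIrregular H r D′ c′ true false →
    m ≢ rootedDeg H r D′ c′ true false true r →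
    LocallyIrregularColouring graph (liftEdges D′) (liftColouring c′)
  lift-irregular D′ c′ irregular hubDeg≢ b u v = edge (view u) (view v)
    where
    deg : Bool → Fin (n graph) → ℕ
    deg = degIn graph (liftEdges D′) (liftColouring c′)

    hubEdge : ∀ i a → ⌊ a ≟ r ⌋ ≡ true → ∀ {b} → true ≡ b → deg b hub ≢ deg b (vertex i a)
    hubEdge i a isRoot refl with a ≟ r
    ... | yes refl = λ degs≡ → hubDeg≢ (trans (sym (degIn-lift-hub D′ c′)) (trans degs≡ (degIn-lift D′ c′ true i r)))
    ... | no _     = contradiction isRoot λ ()

    copyEdge : ∀ i a j a′ → hubAdj (vertex i a) (vertex j a′) ≡ true → liftCol c′ (vertex i a) (vertex j a′) ≡ b →
      deg b (vertex i a) ≢ deg b (vertex j a′)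
    copyEdge i a j a′ e col≡b with same-block i a j a′ e
    ... | refl = λ degs≡ → irregular b a a′ (trans (sym (adj-within i a a′)) e) (trans (sym (liftCol-vertex c′ i a i a′)) col≡b)
                   (trans (sym (degIn-lift D′ c′ b i a)) (trans degs≡ (degIn-lift D′ c′ b i a′)))

    edge : ∀ {u v} → VertexView u → VertexView v → hubAdj u v ≡ true → liftCol c′ u v ≡ b → deg b u ≢ deg b v
    edge isHub        isHub         e col≡b = contradiction e λ ()
    edge isHub        (isCopy j a′) e col≡b = hubEdge j a′ (trans (sym (adj-hub-vertex j a′)) e) col≡b
    edge (isCopy i a) isHub         e col≡b = hubEdge i a (trans (sym (adj-vertex-hub i a)) e) col≡b ∘ sym
    edge (isCopy i a) (isCopy j a′) e col≡b = copyEdge i a j a′ e col≡b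

  reach-within : ∀ i {a a′} → Reach H a a′ → Reach graph (vertex i a) (vertex i a′)
  reach-within i here                 = here
  reach-within i (step {w = w} e walk) = step (trans (adj-within i _ w) e) (reach-within i walk)

  connected : Connected H → Connected graph
  connected (_ , reachH) = connected-via graph hub (toHub ∘ view)
    where
    toHub : ∀ {u} → VertexView u → Reach graph u hub
    toHub isHub        = here
    toHub (isCopy i a) = Reach-snoc (reach-within i (reachH a r)) (trans (adj-vertex-hub i r) (⌊≟⌋-refl r))

  copies≤size : ∀ D → (∀ i → HasDoubledEdge H (restrictEdges D i)) → m ≤ size graph D
  copies≤size D doubled = begin
    m                                                        ≡⟨ sym (sumFin-one m) ⟩
    sumFin m (λ _ → 1)                                       ≤⟨ sumFin-mono m copyHasOne ⟩
    sumFin m (λ i → sumFin (n H) (λ a → row (vertex i a)))   ≡⟨ sym (sumFin-combine m (n H) (row ∘ fs)) ⟩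
    sumFin (m * n H) (row ∘ fs)                              ≤⟨ m≤n+m _ (row hub) ⟩
    size graph D                                             ∎
    where
    open ≤-Reasoning
    entry : Fin (n graph) → Fin (n graph) → ℕ
    entry x y = if ⌊ toℕ x <? toℕ y ⌋ ∧ mem D x y then 1 else 0

    row : Fin (n graph) → ℕ
    row x = sumFin (n graph) (entry x)

    entry-vertex : ∀ i a b → toℕ a < toℕ b → mem D (vertex i a) (vertex i b) ≡ true → entry (vertex i a) (vertex i b) ≡ 1
    entry-vertex i a b a<b d = trans (cong (λ x → if x ∧ mem D (vertex i a) (vertex i b) then 1 else 0) ordered)
                                     (cong (λ x → if x then 1 else 0) d)
      where
      vertex-< : toℕ (vertex i a) < toℕ (vertex i b)
      vertex-< = s≤s (subst₂ _<_ (sym (toℕ-combine i a)) (sym (toℕ-combine i b)) (+-monoʳ-< (n H * toℕ i) a<b))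
      ordered : ⌊ toℕ (vertex i a) <? toℕ (vertex i b) ⌋ ≡ true
      ordered = trans (isYes≗does (_ <? _)) (dec-true (_ <? _) vertex-<)

    copyHasOne : ∀ i → 1 ≤ sumFin (n H) (λ a → row (vertex i a))
    copyHasOne i with doubled i
    ... | a , b , a<b , d = begin
      1                                      ≡⟨ sym (entry-vertex i a b a<b d) ⟩
      entry (vertex i a) (vertex i b)        ≤⟨ term≤sumFin (n graph) (entry (vertex i a)) (vertex i b) ⟩
      row (vertex i a)                       ≤⟨ term≤sumFin (n H) (λ a′ → row (vertex i a′)) a ⟩
      sumFin (n H) (λ a′ → row (vertex i a′)) ∎

-- The gadget: K₄ on 0, 1, 2, 3 and a pendant vertex 4 attached to 0

gadgetAdj : Fin 5 → Fin 5 → Bool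
gadgetAdj 0F 4F = true
gadgetAdj 4F 0F = true
gadgetAdj 4F _  = false
gadgetAdj _  4F = false
gadgetAdj a  b  = not ⌊ a ≟ b ⌋

gadgetAdj-sym : ∀ a b → gadgetAdj a b ≡ gadgetAdj b a
gadgetAdj-sym = from-yes (all? λ a → all? λ b → gadgetAdj a b Bool.≟ gadgetAdj b a)

gadgetAdj-loopless : ∀ a → gadgetAdj a a ≡ false
gadgetAdj-loopless = from-yes (all? λ a → gadgetAdj a a Bool.≟ false)

gadget : Graph
gadget = record { n = 5 ; adj = gadgetAdj ; adjSym = gadgetAdj-sym ; loopless = gadgetAdj-loopless }

gadget-connected : Connected gadget
gadget-connected = connected-via gadget 4F toPendant
  where
  toPendant : ∀ a → Reach gadget a 4F
  toPendant 0F = step refl here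
  toPendant 1F = step {w = 0F} refl (toPendant 0F)
  toPendant 2F = step {w = 0F} refl (toPendant 0F)
  toPendant 3F = step {w = 0F} refl (toPendant 0F)
  toPendant 4F = here

ends : Fin 7 → Fin 5 × Fin 5
ends 0F = 0F , 1F
ends 1F = 0F , 2F
ends 2F = 0F , 3F
ends 3F = 1F , 2F
ends 4F = 1F , 3F
ends 5F = 2F , 3F
ends 6F = 0F , 4F

-- Junk value 0F on non-edges.
edgeIndex : Fin 5 → Fin 5 → Fin 7
edgeIndex 0F 1F = 0F
edgeIndex 1F 0F = 0F
edgeIndex 0F 2F = 1F
edgeIndex 2F 0F = 1F
edgeIndex 0F 3F = 2F
edgeIndex 3F 0F = 2F
edgeIndex 1F 2F = 3F
edgeIndex 2F 1F = 3F
edgeIndex 1F 3F = 4F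
edgeIndex 3F 1F = 4F
edgeIndex 2F 3F = 5F
edgeIndex 3F 2F = 5F
edgeIndex 0F 4F = 6F
edgeIndex 4F 0F = 6F
edgeIndex _  _  = 0F

ends-edgeIndex : ∀ a b → gadgetAdj a b ≡ true → ends (edgeIndex a b) ≡ (a , b) ⊎ ends (edgeIndex a b) ≡ (b , a)
ends-edgeIndex = from-yes (all? λ a → all? λ b →
  (gadgetAdj a b Bool.≟ true) →-dec (≡-dec _≟_ _≟_ (ends (edgeIndex a b)) (a , b) ⊎-dec ≡-dec _≟_ _≟_ (ends (edgeIndex a b)) (b , a)))

edgeColours : (Fin 5 → Fin 5 → Bool) → Vec Bool 7
edgeColours κ = tabulate (uncurry κ ∘ ends)

colourOf : Vec Bool 7 → Fin 5 → Fin 5 → Bool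
colourOf v a b = lookup v (edgeIndex a b)

colourOf-edgeColours : ∀ (c : Colouring gadget) a b → gadgetAdj a b ≡ true → colourOf (edgeColours (col c)) a b ≡ col c a b
colourOf-edgeColours c a b e = trans (lookup∘tabulate (uncurry (col c) ∘ ends) (edgeIndex a b)) (endpoints (ends-edgeIndex a b e))
  where
  endpoints : ends (edgeIndex a b) ≡ (a , b) ⊎ ends (edgeIndex a b) ≡ (b , a) → uncurry (col c) (ends (edgeIndex a b)) ≡ col c a b
  endpoints (inj₁ ab) = cong (uncurry (col c)) ab
  endpoints (inj₂ ba) = trans (cong (uncurry (col c)) ba) (colSym c b a)

simpleDeg : Vec Bool 7 → Bool → Fin 5 → ℕ
simpleDeg v b a = sumFin 5 λ a′ → weight b (colourOf v a a′) (gadgetAdj a a′) false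

degIn-undoubled : ∀ D c → (∀ a b → mem D a b ≡ false) → ∀ b a → degIn gadget D c b a ≡ simpleDeg (edgeColours (col c)) b a
degIn-undoubled D c none b a = sumFin-cong 5 pointwise
  where
  colour′ : Fin 5 → Bool
  colour′ = colourOf (edgeColours (col c)) a

  pointwise : ∀ a′ → weight b (col c a a′) (gadgetAdj a a′) (mem D a a′) ≡ weight b (colour′ a′) (gadgetAdj a a′) false
  pointwise a′ with gadgetAdj a a′ in e
  ... | true  = cong₂ (λ colour → weight b colour true) (sym (colourOf-edgeColours c a a′ e)) (none a a′)
  ... | false = trans (weight-nonadjacent b (col c a a′) (mem D a a′)) (sym (weight-nonadjacent b (colour′ a′) false))

IrregularEdge : Vec Bool 7 → Fin 5 → Fin 5 → Set
IrregularEdge v a b = simpleDeg v (colourOf v a b) a ≢ simpleDeg v (colourOf v a b) b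

K4Irregular : Vec Bool 7 → Set
K4Irregular v = ∀ (x y : Fin 4) → x ≢ y → IrregularEdge v (inject₁ x) (inject₁ y)

-- Checked over all 2⁷ edge colourings. By hand: the colour degrees of 1, 2, 3
-- must be pairwise distinct, which pins the triangle 123 down up to swapping
-- colours, and then both colours of the edge 04 make an edge at 0 regular.
¬K4Irregular : ∀ v → ¬ K4Irregular v
¬K4Irregular v irregular = from-no (anySubset? K4Irregular?) (v , irregular)
  where
  K4Irregular? : ∀ v → Dec (K4Irregular v)
  K4Irregular? v = all? λ x → all? λ y → ¬? (x ≟ y) →-dec ¬? (_ ℕ.≟ _)

K4-adj : ∀ x y → x ≢ y → gadgetAdj (inject₁ x) (inject₁ y) ≡ true
K4-adj = from-yes (all? λ x → all? λ y → ¬? (x ≟ y) →-dec (gadgetAdj (inject₁ x) (inject₁ y) Bool.≟ true))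

gadget-irregular⇒doubled : ∀ D c hubColour hubDoubled →
  RootedIrregular gadget 4F D c hubColour hubDoubled → HasDoubledEdge gadget D
gadget-irregular⇒doubled D c hubColour hubDoubled irregular with hasDoubledEdge? gadget D
... | inj₁ doubled = doubled
... | inj₂ none    = ⊥-elim (¬K4Irregular v K4-irregular)
  where
  v : Vec Bool 7
  v = edgeColours (col c)

  rootedDeg-K4 : ∀ b x → rootedDeg gadget 4F D c hubColour hubDoubled b (inject₁ x) ≡ simpleDeg v b (inject₁ x)
  rootedDeg-K4 b x = cong₂ _+_
    (trans (cong (λ atRoot → weight b hubColour atRoot hubDoubled)
                 (⌊≟⌋-≢ {i = inject₁ x} {4F} (fromℕ≢inject₁ {n = 4} ∘ sym)))
           (weight-nonadjacent b hubColour hubDoubled))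
    (degIn-undoubled D c none b (inject₁ x))

  K4-irregular : K4Irregular v
  K4-irregular x y x≢y rewrite colourOf-edgeColours c (inject₁ x) (inject₁ y) (K4-adj x y x≢y) = λ degs≡ →
    irregular b (inject₁ x) (inject₁ y) (K4-adj x y x≢y) refl
      (trans (rootedDeg-K4 b x) (trans degs≡ (sym (rootedDeg-K4 b y))))
    where b = col c (inject₁ x) (inject₁ y)

doubledInWitness : Fin 5 → Fin 5 → Bool
doubledInWitness 0F 1F = true
doubledInWitness 1F 0F = true
doubledInWitness _  _  = false

colourInWitness : Fin 5 → Fin 5 → Bool
colourInWitness 1F 3F = false
colourInWitness 3F 1F = false
colourInWitness 2F 3F = false
colourInWitness 3F 2F = false
colourInWitness _  _  = true

witnessEdges : EdgeSet gadget
witnessEdges = record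
  { mem    = doubledInWitness
  ; memSym = from-yes (all? λ a → all? λ b → doubledInWitness a b Bool.≟ doubledInWitness b a)
  ; memSub = from-yes (all? λ a → all? λ b → (doubledInWitness a b Bool.≟ true) →-dec (gadgetAdj a b Bool.≟ true))
  }

witnessColouring : Colouring gadget
witnessColouring = record
  { col    = colourInWitness
  ; colSym = from-yes (all? λ a → all? λ b → colourInWitness a b Bool.≟ colourInWitness b a)
  }

-- With the hub edge coloured true, the true-degrees of 0, 1, 2, 3, 4 are 5, 3, 2, 1, 2
-- and the false-degrees of 1, 2, 3 are 1, 1, 2; the hub's true-degree m must avoid 2.
witness-irregular : RootedIrregular gadget 4F witnessEdges witnessColouring true false
witness-irregular b a a′ e refl = from-yes (all? λ a → all? λ a′ → (gadgetAdj a a′ Bool.≟ true) →-dec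
  ¬? (deg (colourInWitness a a′) a ℕ.≟ deg (colourInWitness a a′) a′)) a a′ e
  where
  deg : Bool → Fin 5 → ℕ
  deg = rootedDeg gadget 4F witnessEdges witnessColouring true false

mainTheorem6 : ∀ (k : ℕ) → Σ Graph λ G →
    Connected G × ¬ Isomorphic G (K 2) × ¬ Isomorphic G (K 3) × DlirAtLeast G k
mainTheorem6 k =
  graph , connected gadget-connected , tooBig (K 2) (λ ()) , tooBig (K 3) (λ ()) ,
  (admissible , λ D (c , irregular) → ≤-trans (m≤n+m k 3)
    (copies≤size D λ i → gadget-irregular⇒doubled (restrictEdges D i) (restrictColouring c i) _ _
                                                  (restrict-irregular D c irregular i)))
  where
  open Hub gadget 4F (3 + k)

  tooBig : ∀ H → n graph ≢ n H → ¬ Isomorphic graph H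
  tooBig H sizes≢ iso = sizes≢ (Isomorphic⇒≡ graph H iso)

  admissible : Σ (EdgeSet graph) (Admissible graph)
  admissible = liftEdges witnessEdges , liftColouring witnessColouring ,
               lift-irregular witnessEdges witnessColouring witness-irregular λ ()
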